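{- Let $k\ge 3$ and, for integers $n\ge k$ and $0\le m\le n$, let $$\omega_{n,m,k}=\sum_{s=0}^{k}(-1)^s\binom{m}{s}\binom{n-m}{k-s}.$$ Suppose $L\le n$ and either $m-\frac n2\le -n^{1-\frac{4}{3k}}$, or $k$ is even and $m-\frac n2\ge n^{1-\frac{4}{3k}}$. Then $$\left|\frac{\bigl(1+\omega_{n,m,k}/\binom nk\bigr)^L}{\bigl(1+(1-\frac{2m}{n})^k\bigr)^L}\right|=O(1),$$ i.e. this ratio is bounded by a constant depending only on $k$, uniformly in such $L$ and $m$, for all sufficiently large $n$.
   Context: Binomial coefficients $\binom{a}{b}$ are $0$ when $b>a$ or $b<0$. -}

module Defs where

open import Data.Nat as ℕ using (ℕ; zero; suc; _∸_)
open import Data.Nat.Combinatorics using (_C_)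
open import Data.Integer as ℤ using (ℤ; +_)
open import Data.Rational as ℚ using (ℚ; 0ℚ; 1ℚ; _÷_; _/_)
open import Data.Rational.Properties using (_≟_)
open import Relation.Nullary using (yes; no)

sgn : ℕ → ℤ
sgn zero = ℤ.1ℤ
sgn (suc s) = ℤ.- sgn s

sumTo : ℕ → (ℕ → ℤ) → ℤ
sumTo zero f = f 0
sumTo (suc t) f = sumTo t f ℤ.+ f (suc t)

ω : ℕ → ℕ → ℕ → ℤ
ω n m k = sumTo k (λ s → sgn s ℤ.* (+ (m C s) ℤ.* + ((n ∸ m) C (k ∸ s))))

_^ℚ_ : ℚ → ℕ → ℚ
q ^ℚ zero = 1ℚ
q ^ℚ suc e = q ℚ.* (q ^ℚ e)

-- total division on ℚ (value at q = 0 is irrelevant; only used with q ≠ 0)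
divQ : ℚ → ℚ → ℚ
divQ p q with q ≟ 0ℚ
... | yes _ = 0ℚ
... | no q≢0 = _÷_ p q {{ℚ.≢-nonZero q≢0}}

ℕtoℚ : ℕ → ℚ
ℕtoℚ n = (+ n) / 1

numBase : ℕ → ℕ → ℕ → ℚ
numBase n m k = 1ℚ ℚ.+ divQ ((ω n m k) / 1) (ℕtoℚ (n C k))

denBase : ℕ → ℕ → ℕ → ℚ
denBase n m k = 1ℚ ℚ.+ ((1ℚ ℚ.- divQ (ℕtoℚ (2 ℕ.* m)) (ℕtoℚ n)) ^ℚ k)

shift : ℕ → ℕ → ℚ
shift n m = ℕtoℚ m ℚ.- divQ (ℕtoℚ n) (ℕtoℚ 2)

-- |y| ≥ n^{1 - 4/(3k)} for y with the given sign, stated without real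
-- exponents: y ≥ 0 and y^{3k} ≥ n^{3k-4}.
geqThreshold : ℕ → ℕ → ℚ → Set
geqThreshold n k y = (0ℚ ℚ.≤ y) × (ℕtoℚ n ^ℚ (3 ℕ.* k ∸ 4) ℚ.≤ y ^ℚ (3 ℕ.* k))
  where open import Data.Product using (_×_)

module Submission where

-- With p = n − m and d = p − m, the value K_j = ω_{n,m,j} is the Krawtchouk
-- polynomial Δ^m C(p, ·) at j. It obeys the three-term recurrence
-- (j + 2) K_{j+2} = d K_{j+1} − (n − j) K_j with K_1 = d K_0, because C(p, ·)
-- does and taking a difference shifts (d, n) to (d − 1, n + 1). For
-- V_j = j! (n − j)! K_j = n! K_j / C(n, j) this becomes
-- n V_{j+1} − d V_j = j (V_{j+1} − V_{j−1}), while |V_j| ≤ n! as |K_j| ≤ C(n, j);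
-- comparing V with the geometric sequence n! (d/n)^j gives
-- |ω/C(n, k) − (1 − 2m/n)^k| ≤ k²/n.
--
-- Either hypothesis makes (1 − 2m/n)^k ≥ 0, so |1 + ω/C(n, k)| ≤ (1 + (1 − 2m/n)^k)(1 + k²/n) and
-- the ratio is at most (1 + k²/n)^L ≤ (1 + y)^{2k²L} ≤ 2^{2k²} for y = 1/(2n):
-- by Bernoulli (1 − y)^L ≥ 1 − Ly ≥ 1/2, while (1 + y)^L (1 − y)^L ≤ 1.

open import Defs

module Krawtchouk where
  open import Data.Nat as ℕ using (ℕ; zero; suc; _∸_; _!)
  import Data.Nat.Properties as ℕP
  import Data.Nat.Tactic.RingSolver as ℕS
  open import Data.Nat.Combinatorics using (_C_; nCk+nC[k+1]≡[n+1]C[k+1]; nC1≡n; k![n∸k]!∣n!)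
  open import Data.Nat.Combinatorics.Specification using (nCk≡n!/k![n-k]!)
  open import Data.Nat.DivMod using (m/n*n≡m)
  open import Data.Integer as ℤ using (ℤ; +_; _+_; _-_; _*_; -_; ∣_∣)
  import Data.Integer.Properties as ℤP
  open import Data.Integer.Tactic.RingSolver using (solve-∀; solve)
  open import Data.List using (_∷_; [])
  open import Data.Product using (_,_)
  open import Relation.Binary.PropositionalEquality

  sumTo-cong : ∀ t {f g : ℕ → ℤ} → (∀ s → f s ≡ g s) → sumTo t f ≡ sumTo t g
  sumTo-cong zero    f≗g = f≗g 0
  sumTo-cong (suc t) f≗g = cong₂ _+_ (sumTo-cong t f≗g) (f≗g (suc t))

  sumTo-head : ∀ t (f : ℕ → ℤ) → (∀ s → f (suc s) ≡ + 0) → sumTo t f ≡ f 0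
  sumTo-head zero    f tail≡0 = refl
  sumTo-head (suc t) f tail≡0 rewrite sumTo-head t f tail≡0 | tail≡0 t = ℤP.+-identityʳ (f 0)

  sumTo-suc : ∀ t (f : ℕ → ℤ) → sumTo (suc t) f ≡ f 0 + sumTo t (λ s → f (suc s))
  sumTo-suc zero    f = refl
  sumTo-suc (suc t) f rewrite sumTo-suc t f = ℤP.+-assoc (f 0) _ _

  sumTo-distrib-- : ∀ t (f g : ℕ → ℤ) → sumTo t (λ s → f s - g s) ≡ sumTo t f - sumTo t g
  sumTo-distrib-- zero    f g = refl
  sumTo-distrib-- (suc t) f g rewrite sumTo-distrib-- t f g =
    interchange (sumTo t f) (sumTo t g) (f (suc t)) (g (suc t))
    where
    interchange : ∀ a b c d → (a - b) + (c - d) ≡ (a + c) - (b + d)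
    interchange = solve-∀

  krawtchouk : ℕ → ℕ → ℕ → ℤ
  krawtchouk m p k = sumTo k (λ s → sgn s * (+ (m C s) * + (p C (k ∸ s))))

  Δ : (ℕ → ℤ) → ℕ → ℤ
  Δ f zero    = f zero
  Δ f (suc j) = f (suc j) - f j

  krawtchouk-zeroˡ : ∀ p k → krawtchouk 0 p k ≡ + (p C k)
  krawtchouk-zeroˡ p k = begin
    krawtchouk 0 p k
      ≡⟨ sumTo-head k _ (λ s → ℤP.*-zeroʳ (sgn (suc s))) ⟩
    + 1 * (+ 1 * + (p C k))
      ≡⟨ ℤP.*-identityˡ _ ⟩
    + 1 * + (p C k)
      ≡⟨ ℤP.*-identityˡ _ ⟩
    + (p C k) ∎
    where open ≡-Reasoning

  krawtchouk-sucˡ : ∀ m p k → krawtchouk (suc m) p k ≡ Δ (krawtchouk m p) k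
  krawtchouk-sucˡ m p zero    = refl
  krawtchouk-sucˡ m p (suc k) = begin
    krawtchouk (suc m) p (suc k)
      ≡⟨ sumTo-suc k _ ⟩
    f 0 + sumTo k (λ s → sgn (suc s) * (+ (suc m C suc s) * + (p C (k ∸ s))))
      ≡⟨ cong (λ x → f 0 + x) (sumTo-cong k pascal) ⟩
    f 0 + sumTo k (λ s → f (suc s) - h s)
      ≡⟨ cong (λ x → f 0 + x) (sumTo-distrib-- k (λ s → f (suc s)) h) ⟩
    f 0 + (sumTo k (λ s → f (suc s)) - sumTo k h)
      ≡⟨ ℤP.+-assoc (f 0) _ _ ⟨
    (f 0 + sumTo k (λ s → f (suc s))) - sumTo k h
      ≡⟨ cong (_- sumTo k h) (sumTo-suc k f) ⟨
    krawtchouk m p (suc k) - krawtchouk m p k ∎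
    where
    open ≡-Reasoning
    f h : ℕ → ℤ
    f s = sgn s * (+ (m C s) * + (p C (suc k ∸ s)))
    h s = sgn s * (+ (m C s) * + (p C (k ∸ s)))
    split : ∀ σ a b c → - σ * ((a + b) * c) ≡ - σ * (b * c) - σ * (a * c)
    split = solve-∀
    pascal : ∀ s → sgn (suc s) * (+ (suc m C suc s) * + (p C (k ∸ s))) ≡ f (suc s) - h s
    pascal s rewrite sym (nCk+nC[k+1]≡[n+1]C[k+1] m s) =
      split (sgn s) (+ (m C s)) (+ (m C suc s)) (+ (p C (k ∸ s)))

  binomial-absorption : ∀ p j → + suc j * + (p C suc j) ≡ (+ p - + j) * + (p C j)
  binomial-absorption zero    zero    = refl
  binomial-absorption zero    (suc j) = trans (ℤP.*-zeroʳ (+ suc (suc j))) (sym (ℤP.*-zeroʳ (- + suc j)))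
  binomial-absorption (suc p) zero    rewrite nC1≡n (suc p) =
    trans (ℤP.*-identityˡ (+ suc p))
          (sym (trans (ℤP.*-identityʳ (+ suc p - + 0)) (ℤP.+-identityʳ (+ suc p))))
  binomial-absorption (suc p) (suc j)
    rewrite sym (nCk+nC[k+1]≡[n+1]C[k+1] p (suc j)) | sym (nCk+nC[k+1]≡[n+1]C[k+1] p j) = begin
    + (2 ℕ.+ j) * (c₀ + c₁)
      ≡⟨ ℤP.*-distribˡ-+ (+ (2 ℕ.+ j)) c₀ c₁ ⟩
    + (2 ℕ.+ j) * c₀ + + (2 ℕ.+ j) * c₁
      ≡⟨ cong (λ x → + (2 ℕ.+ j) * c₀ + x) (binomial-absorption p (suc j)) ⟩
    + (2 ℕ.+ j) * c₀ + (+ p - + suc j) * c₀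
      ≡⟨ collect (+ p) (+ j) c₀ ⟩
    + suc j * c₀ + (+ p - + j) * c₀
      ≡⟨ cong (_+ (+ p - + j) * c₀) (binomial-absorption p j) ⟩
    (+ p - + j) * c₋ + (+ p - + j) * c₀
      ≡⟨ ℤP.*-distribˡ-+ (+ p - + j) c₋ c₀ ⟨
    (+ p - + j) * (c₋ + c₀)
      ≡⟨ cong (_* (c₋ + c₀)) (trans (ℤP.m-n≡m⊖n p j) (sym (ℤP.[1+m]⊖[1+n]≡m⊖n p j))) ⟩
    (+ suc p - + suc j) * (c₋ + c₀) ∎
    where
    open ≡-Reasoning
    c₋ = + (p C j)
    c₀ = + (p C suc j)
    c₁ = + (p C suc (suc j))
    collect : ∀ P J c → (+ 2 + J) * c + (P - (+ 1 + J)) * c ≡ (+ 1 + J) * c + (P - J) * c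
    collect = solve-∀

  -- initial is step at j = −1 with f (−1) = 0; Δ needs it to preserve the recurrence.
  record Recurrent (d N : ℤ) (f : ℕ → ℤ) : Set where
    field
      initial : f 1 ≡ d * f 0
      step    : ∀ j → + (2 ℕ.+ j) * f (2 ℕ.+ j) ≡ d * f (suc j) - (N - + j) * f j

  Recurrent-resp : ∀ {d d′ N N′ f g} → d ≡ d′ → N ≡ N′ → (∀ j → f j ≡ g j) →
                   Recurrent d N f → Recurrent d′ N′ g
  Recurrent-resp {d} {N = N} {g = g} refl refl f≗g rec = record
    { initial = subst₂ (λ a b → a ≡ d * b) (f≗g 1) (f≗g 0) initial
    ; step    = step′
    }
    where
    open Recurrent rec
    step′ : ∀ j → + (2 ℕ.+ j) * g (2 ℕ.+ j) ≡ d * g (suc j) - (N - + j) * g j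
    step′ j rewrite sym (f≗g (2 ℕ.+ j)) | sym (f≗g (suc j)) | sym (f≗g j) = step j

  binomial-recurrent : ∀ p → Recurrent (+ p) (+ p) (λ j → + (p C j))
  binomial-recurrent p = record { initial = first ; step = step }
    where
    first : + (p C 1) ≡ + p * + 1
    first rewrite nC1≡n p = sym (ℤP.*-identityʳ (+ p))
    split : ∀ P J c → (P - (+ 1 + J)) * c ≡ P * c - (+ 1 + J) * c
    split = solve-∀
    step : ∀ j → + (2 ℕ.+ j) * + (p C (2 ℕ.+ j)) ≡ + p * + (p C suc j) - (+ p - + j) * + (p C j)
    step j = begin
      + (2 ℕ.+ j) * + (p C (2 ℕ.+ j))
        ≡⟨ binomial-absorption p (suc j) ⟩
      (+ p - + suc j) * + (p C suc j)
        ≡⟨ split (+ p) (+ j) _ ⟩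
      + p * + (p C suc j) - + suc j * + (p C suc j)
        ≡⟨ cong (λ x → + p * + (p C suc j) - x) (binomial-absorption p j) ⟩
      + p * + (p C suc j) - (+ p - + j) * + (p C j) ∎
      where open ≡-Reasoning

  Δ-recurrent : ∀ {d N f} → Recurrent d N f → Recurrent (d - + 1) (N + + 1) (Δ f)
  Δ-recurrent {d} {N} {f} rec = record { initial = Δfirst ; step = Δstep }
    where
    open Recurrent rec renaming (initial to first)
    open ≡-Reasoning
    Δfirst : f 1 - f 0 ≡ (d - + 1) * f 0
    Δfirst = trans (cong (_- f 0) first) (factor d (f 0))
      where
      factor : ∀ d x → d * x - x ≡ (d - + 1) * x
      factor = solve-∀
    start : ∀ f₀ f₁ f₂ → f₁ ≡ d * f₀ → + 2 * f₂ ≡ d * f₁ - (N - + 0) * f₀ →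
            + 2 * (f₂ - f₁) ≡ (d - + 1) * (f₁ - f₀) - ((N + + 1) - + 0) * f₀
    start f₀ .(d * f₀) f₂ refl rec₀ = begin
      + 2 * (f₂ - d * f₀)
        ≡⟨ solve (f₂ ∷ d ∷ f₀ ∷ []) ⟩
      + 2 * f₂ - + 2 * (d * f₀)
        ≡⟨ cong (_- + 2 * (d * f₀)) rec₀ ⟩
      d * (d * f₀) - (N - + 0) * f₀ - + 2 * (d * f₀)
        ≡⟨ solve (d ∷ N ∷ f₀ ∷ []) ⟩
      (d - + 1) * (d * f₀ - f₀) - ((N + + 1) - + 0) * f₀ ∎
    next : ∀ J f₀ f₁ f₂ f₃ → (+ 2 + J) * f₂ ≡ d * f₁ - (N - J) * f₀ →
           (+ 3 + J) * f₃ ≡ d * f₂ - (N - (+ 1 + J)) * f₁ →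
           (+ 3 + J) * (f₃ - f₂) ≡ (d - + 1) * (f₂ - f₁) - ((N + + 1) - (+ 1 + J)) * (f₁ - f₀)
    next J f₀ f₁ f₂ f₃ rec₀ rec₁ = begin
      (+ 3 + J) * (f₃ - f₂)
        ≡⟨ solve (J ∷ f₂ ∷ f₃ ∷ []) ⟩
      (+ 3 + J) * f₃ - (+ 2 + J) * f₂ - f₂
        ≡⟨ cong₂ (λ x y → x - y - f₂) rec₁ rec₀ ⟩
      (d * f₂ - (N - (+ 1 + J)) * f₁) - (d * f₁ - (N - J) * f₀) - f₂
        ≡⟨ solve (d ∷ N ∷ J ∷ f₀ ∷ f₁ ∷ f₂ ∷ []) ⟩
      (d - + 1) * (f₂ - f₁) - ((N + + 1) - (+ 1 + J)) * (f₁ - f₀) ∎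
    Δstep : ∀ j → + (2 ℕ.+ j) * Δ f (2 ℕ.+ j)
                    ≡ (d - + 1) * Δ f (suc j) - ((N + + 1) - + j) * Δ f j
    Δstep zero    = start (f 0) (f 1) (f 2) first (step 0)
    Δstep (suc j) = next (+ j) (f j) (f (suc j)) (f (2 ℕ.+ j)) (f (3 ℕ.+ j)) (step j) (step (suc j))

  krawtchouk-recurrent : ∀ m p → Recurrent (+ p - + m) (+ m + + p) (krawtchouk m p)
  krawtchouk-recurrent zero    p =
    Recurrent-resp {f = λ j → + (p C j)} (sym (ℤP.+-identityʳ (+ p))) refl
      (λ j → sym (krawtchouk-zeroˡ p j)) (binomial-recurrent p)
  krawtchouk-recurrent (suc m) p =
    Recurrent-resp {f = Δ (krawtchouk m p)} (shift-d (+ p) (+ m)) (shift-N (+ m) (+ p))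
      (λ j → sym (krawtchouk-sucˡ m p j)) (Δ-recurrent (krawtchouk-recurrent m p))
    where
    shift-d : ∀ a b → (a - b) - + 1 ≡ a - (+ 1 + b)
    shift-d = solve-∀
    shift-N : ∀ a b → (a + b) + + 1 ≡ (+ 1 + a) + b
    shift-N = solve-∀

  ∣krawtchouk∣≤binomial : ∀ m p k → ∣ krawtchouk m p k ∣ ℕ.≤ (m ℕ.+ p) C k
  ∣krawtchouk∣≤binomial zero    p k       rewrite krawtchouk-zeroˡ p k = ℕP.≤-refl
  ∣krawtchouk∣≤binomial (suc m) p zero    = ℕP.≤-refl
  ∣krawtchouk∣≤binomial (suc m) p (suc k) rewrite krawtchouk-sucˡ m p (suc k) = begin
    ∣ krawtchouk m p (suc k) - krawtchouk m p k ∣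
      ≤⟨ ℤP.∣i-j∣≤∣i∣+∣j∣ (krawtchouk m p (suc k)) (krawtchouk m p k) ⟩
    ∣ krawtchouk m p (suc k) ∣ ℕ.+ ∣ krawtchouk m p k ∣
      ≤⟨ ℕP.+-mono-≤ (∣krawtchouk∣≤binomial m p (suc k)) (∣krawtchouk∣≤binomial m p k) ⟩
    (m ℕ.+ p) C suc k ℕ.+ (m ℕ.+ p) C k
      ≡⟨ ℕP.+-comm ((m ℕ.+ p) C suc k) _ ⟩
    (m ℕ.+ p) C k ℕ.+ (m ℕ.+ p) C suc k
      ≡⟨ nCk+nC[k+1]≡[n+1]C[k+1] (m ℕ.+ p) k ⟩
    suc (m ℕ.+ p) C suc k ∎
    where open ℕP.≤-Reasoning

  scaled : ℕ → (ℕ → ℤ) → ℕ → ℤ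
  scaled n f j = + (j !) * + ((n ∸ j) !) * f j

  scaled-zero : ∀ n f → scaled n f 0 ≡ + (n !) * f 0
  scaled-zero n f = cong (_* f 0) (ℤP.*-identityˡ (+ (n !)))

  [2+i+r]∸i≡2+r : ∀ i r → suc (suc (i ℕ.+ r)) ∸ i ≡ suc (suc r)
  [2+i+r]∸i≡2+r zero    r = refl
  [2+i+r]∸i≡2+r (suc i) r = [2+i+r]∸i≡2+r i r

  [2+i+r]∸[1+i]≡1+r : ∀ i r → suc (suc (i ℕ.+ r)) ∸ suc i ≡ suc r
  [2+i+r]∸[1+i]≡1+r zero    r = refl
  [2+i+r]∸[1+i]≡1+r (suc i) r = [2+i+r]∸[1+i]≡1+r i r

  +[1+j]! : ∀ j → + (suc j !) ≡ + suc j * + (j !)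
  +[1+j]! j = ℤP.pos-* (suc j) (j !)

  scaled-recurrence : ∀ {d f} i r → Recurrent d (+ (2 ℕ.+ i ℕ.+ r)) f →
                      + suc r * scaled (2 ℕ.+ i ℕ.+ r) f (2 ℕ.+ i)
                        ≡ d * scaled (2 ℕ.+ i ℕ.+ r) f (suc i) - + suc i * scaled (2 ℕ.+ i ℕ.+ r) f i
  scaled-recurrence {d} {f} i r rec = begin
    + suc r * (+ ((2 ℕ.+ i) !) * + ((n ∸ (2 ℕ.+ i)) !) * f₂)
      ≡⟨ cong₂ (λ a b → + suc r * (a * + (b !) * f₂)) F₂ (ℕP.m+n∸m≡n i r) ⟩
    + suc r * (+ (2 ℕ.+ i) * (+ suc i * Fi) * Fr * f₂)
      ≡⟨ regroup₁ (+ i) (+ r) Fi Fr f₂ ⟩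
    c * (+ (2 ℕ.+ i) * f₂)
      ≡⟨ cong (c *_) (Recurrent.step rec i) ⟩
    c * (d * f₁ - (+ n - + i) * f₀)
      ≡⟨ regroup₂ (+ i) (+ r) Fi Fr d f₀ f₁ ⟩
    d * (+ suc i * Fi * (+ suc r * Fr) * f₁) - + suc i * (Fi * (+ (2 ℕ.+ r) * (+ suc r * Fr)) * f₀)
      ≡⟨ cong₂ (λ a b → d * a - + suc i * b) V₁ V₀ ⟨
    d * scaled n f (suc i) - + suc i * scaled n f i ∎
    where
    open ≡-Reasoning
    n = 2 ℕ.+ i ℕ.+ r
    f₀ = f i
    f₁ = f (suc i)
    f₂ = f (2 ℕ.+ i)
    Fi = + (i !)
    Fr = + (r !)
    c = (+ suc i * Fi) * (+ suc r * Fr)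
    F₂ : + ((2 ℕ.+ i) !) ≡ + (2 ℕ.+ i) * (+ suc i * Fi)
    F₂ = trans (+[1+j]! (suc i)) (cong (+ (2 ℕ.+ i) *_) (+[1+j]! i))
    V₁ : scaled n f (suc i) ≡ + suc i * Fi * (+ suc r * Fr) * f₁
    V₁ = cong₂ (λ a b → a * b * f₁) (+[1+j]! i)
           (trans (cong (λ x → + (x !)) ([2+i+r]∸[1+i]≡1+r i r)) (+[1+j]! r))
    V₀ : scaled n f i ≡ Fi * (+ (2 ℕ.+ r) * (+ suc r * Fr)) * f₀
    V₀ = cong (λ a → Fi * a * f₀)
           (trans (cong (λ x → + (x !)) ([2+i+r]∸i≡2+r i r))
                  (trans (+[1+j]! (suc r)) (cong (+ (2 ℕ.+ r) *_) (+[1+j]! r))))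
    regroup₁ : ∀ I R Fi Fr x → (+ 1 + R) * ((+ 2 + I) * ((+ 1 + I) * Fi) * Fr * x)
                               ≡ ((+ 1 + I) * Fi) * ((+ 1 + R) * Fr) * ((+ 2 + I) * x)
    regroup₁ = solve-∀
    regroup₂ : ∀ I R Fi Fr d x₀ x₁ →
               ((+ 1 + I) * Fi) * ((+ 1 + R) * Fr) * (d * x₁ - ((+ 2 + I + R) - I) * x₀)
               ≡ d * ((+ 1 + I) * Fi * ((+ 1 + R) * Fr) * x₁)
                 - (+ 1 + I) * (Fi * ((+ 2 + R) * ((+ 1 + R) * Fr)) * x₀)
    regroup₂ = solve-∀

  -- At j = 0 the factor + j makes the ℕ.pred term irrelevant.
  scaled-step : ∀ {d n f} → Recurrent d (+ n) f → ∀ j → suc j ℕ.≤ n →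
                + n * scaled n f (suc j) - d * scaled n f j
                  ≡ + j * (scaled n f (suc j) - scaled n f (ℕ.pred j))
  scaled-step {d} {suc n} {f} rec zero _ = begin
    + suc n * scaled (suc n) f 1 - d * scaled (suc n) f 0
      ≡⟨ cong₂ (λ x y → + suc n * (+ 1 * + (n !) * x) - d * (+ 1 * y * f 0))
        (Recurrent.initial rec) (+[1+j]! n) ⟩
    + suc n * (+ 1 * + (n !) * (d * f 0)) - d * (+ 1 * (+ suc n * + (n !)) * f 0)
      ≡⟨ cancel (+ suc n) (+ (n !)) d (f 0) ⟩
    + 0 ∎
    where
    open ≡-Reasoning
    cancel : ∀ N F d x → N * (+ 1 * F * (d * x)) - d * (+ 1 * (N * F) * x) ≡ + 0
    cancel = solve-∀
  scaled-step {d} {n} {f} rec (suc i) 2+i≤n with ℕP.m≤n⇒∃[o]m+o≡n 2+i≤n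
  ... | r , refl = begin
    + n * V₂ - d * V₁
      ≡⟨ split (+ i) (+ r) V₂ (d * V₁) ⟩
    + suc i * V₂ + (+ suc r * V₂ - d * V₁)
      ≡⟨ cong (λ x → + suc i * V₂ + (x - d * V₁)) (scaled-recurrence i r rec) ⟩
    + suc i * V₂ + ((d * V₁ - + suc i * V₀) - d * V₁)
      ≡⟨ collapse (+ suc i) V₂ V₀ (d * V₁) ⟩
    + suc i * (V₂ - V₀) ∎
    where
    open ≡-Reasoning
    V₀ = scaled n f i
    V₁ = scaled n f (suc i)
    V₂ = scaled n f (2 ℕ.+ i)
    split : ∀ I R a b → (+ 2 + I + R) * a - b ≡ (+ 1 + I) * a + ((+ 1 + R) * a - b)
    split = solve-∀
    collapse : ∀ c a₂ a₀ b → c * a₂ + ((b - c * a₀) - b) ≡ c * (a₂ - a₀)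
    collapse = solve-∀

  nCk*[k!*[n∸k]!]≡n! : ∀ {n k} → k ℕ.≤ n → (n C k) ℕ.* (k ! ℕ.* (n ∸ k) !) ≡ n !
  nCk*[k!*[n∸k]!]≡n! {n} {k} k≤n =
    trans (cong (ℕ._* (k ! ℕ.* (n ∸ k) !)) (nCk≡n!/k![n-k]! k≤n)) (m/n*n≡m (k![n∸k]!∣n! k≤n))
    where instance _ = k ℕP.!* (n ∸ k) !≢0

  ∣scaled∣≤n! : ∀ {n f} → (∀ j → ∣ f j ∣ ℕ.≤ n C j) → ∀ j → j ℕ.≤ n → ∣ scaled n f j ∣ ℕ.≤ n !
  ∣scaled∣≤n! {n} {f} ∣f∣≤C j j≤n = begin
    ∣ + (j !) * + ((n ∸ j) !) * f j ∣
      ≡⟨ ℤP.abs-* (+ (j !) * + ((n ∸ j) !)) (f j) ⟩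
    ∣ + (j !) * + ((n ∸ j) !) ∣ ℕ.* ∣ f j ∣
      ≡⟨ cong (λ x → ∣ x ∣ ℕ.* ∣ f j ∣) (ℤP.pos-* (j !) ((n ∸ j) !)) ⟨
    (j ! ℕ.* (n ∸ j) !) ℕ.* ∣ f j ∣
      ≤⟨ ℕP.*-monoʳ-≤ (j ! ℕ.* (n ∸ j) !) (∣f∣≤C j) ⟩
    (j ! ℕ.* (n ∸ j) !) ℕ.* (n C j)
      ≡⟨ ℕP.*-comm (j ! ℕ.* (n ∸ j) !) (n C j) ⟩
    (n C j) ℕ.* (j ! ℕ.* (n ∸ j) !)
      ≡⟨ nCk*[k!*[n∸k]!]≡n! j≤n ⟩
    n ! ∎
    where open ℕP.≤-Reasoning

  scaled-step-bound : ∀ {d n f} → Recurrent d (+ n) f → (∀ j → ∣ f j ∣ ℕ.≤ n C j) →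
                      ∀ j → suc j ℕ.≤ n →
                      ∣ + n * scaled n f (suc j) - d * scaled n f j ∣ ℕ.≤ j ℕ.* (n ! ℕ.+ n !)
  scaled-step-bound {d} {n} {f} rec ∣f∣≤C j j<n = begin
    ∣ + n * scaled n f (suc j) - d * scaled n f j ∣
      ≡⟨ cong ∣_∣ (scaled-step rec j j<n) ⟩
    ∣ + j * (V (suc j) - V (ℕ.pred j)) ∣
      ≡⟨ ℤP.abs-* (+ j) (V (suc j) - V (ℕ.pred j)) ⟩
    j ℕ.* ∣ V (suc j) - V (ℕ.pred j) ∣
      ≤⟨ ℕP.*-monoʳ-≤ j (ℤP.∣i-j∣≤∣i∣+∣j∣ (V (suc j)) (V (ℕ.pred j))) ⟩
    j ℕ.* (∣ V (suc j) ∣ ℕ.+ ∣ V (ℕ.pred j) ∣)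
      ≤⟨ ℕP.*-monoʳ-≤ j (ℕP.+-mono-≤ (bound (suc j) j<n) (bound (ℕ.pred j) pred≤n)) ⟩
    j ℕ.* (n ! ℕ.+ n !) ∎
    where
    open ℕP.≤-Reasoning
    V = scaled n f
    bound = ∣scaled∣≤n! {n} {f} ∣f∣≤C
    pred≤n : ℕ.pred j ℕ.≤ n
    pred≤n = ℕP.≤-trans (ℕP.pred[n]≤n {j}) (ℕP.≤-trans (ℕP.n≤1+n j) j<n)

  geometric-approximation : ∀ {n M N d} (a : ℕ → ℤ) → ∣ d ∣ ℕ.≤ n →
    (∀ j → suc j ℕ.≤ N → ∣ + n * a (suc j) - d * a j ∣ ℕ.≤ j ℕ.* (M ℕ.+ M)) →
    ∀ j → j ℕ.≤ N →
    n ℕ.* ∣ + (n ℕ.^ j) * a j - d ℤ.^ j * a 0 ∣ ℕ.≤ j ℕ.* j ℕ.* (M ℕ.* n ℕ.^ j)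
  geometric-approximation {n} a _ _ zero _ =
    ℕP.≤-reflexive (trans (cong (λ x → n ℕ.* ∣ x ∣) (ℤP.+-inverseʳ (+ 1 * a 0))) (ℕP.*-zeroʳ n))
  geometric-approximation {n} {M} {N} {d} a ∣d∣≤n step-bound (suc j) j<N = begin
    n ℕ.* ∣ + (n ℕ.* P) * a (suc j) - d * d ℤ.^ j * a 0 ∣
      ≡⟨ cong (λ x → n ℕ.* ∣ x ∣) error-step ⟩
    n ℕ.* ∣ + P * X + d * U ∣
      ≤⟨ ℕP.*-monoʳ-≤ n (ℤP.∣i+j∣≤∣i∣+∣j∣ (+ P * X) (d * U)) ⟩
    n ℕ.* (∣ + P * X ∣ ℕ.+ ∣ d * U ∣)
      ≡⟨ cong₂ (λ x y → n ℕ.* (x ℕ.+ y)) (ℤP.abs-* (+ P) X) (ℤP.abs-* d U) ⟩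
    n ℕ.* (P ℕ.* ∣ X ∣ ℕ.+ ∣ d ∣ ℕ.* ∣ U ∣)
      ≡⟨ distribute n P (∣ X ∣) (∣ d ∣) (∣ U ∣) ⟩
    n ℕ.* P ℕ.* ∣ X ∣ ℕ.+ ∣ d ∣ ℕ.* (n ℕ.* ∣ U ∣)
      ≤⟨ ℕP.+-mono-≤ (ℕP.*-monoʳ-≤ (n ℕ.* P) (step-bound j j<N))
                     (ℕP.*-mono-≤ ∣d∣≤n induction-hypothesis) ⟩
    n ℕ.* P ℕ.* (j ℕ.* (M ℕ.+ M)) ℕ.+ n ℕ.* (j ℕ.* j ℕ.* (M ℕ.* P))
      ≤⟨ ℕP.m≤m+n _ (M ℕ.* (n ℕ.* P)) ⟩
    n ℕ.* P ℕ.* (j ℕ.* (M ℕ.+ M)) ℕ.+ n ℕ.* (j ℕ.* j ℕ.* (M ℕ.* P)) ℕ.+ M ℕ.* (n ℕ.* P)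
      ≡⟨ complete-square n P j M ⟩
    suc j ℕ.* suc j ℕ.* (M ℕ.* (n ℕ.* P)) ∎
    where
    open ℕP.≤-Reasoning
    P = n ℕ.^ j
    X = + n * a (suc j) - d * a j
    U = + P * a j - d ℤ.^ j * a 0
    induction-hypothesis : n ℕ.* ∣ U ∣ ℕ.≤ j ℕ.* j ℕ.* (M ℕ.* P)
    induction-hypothesis =
      geometric-approximation {n} {M} {N} a ∣d∣≤n step-bound j (ℕP.≤-trans (ℕP.n≤1+n j) j<N)
    unfold : ∀ n P x₁ x₀ d Dj y →
             n * P * x₁ - d * Dj * y ≡ P * (n * x₁ - d * x₀) + d * (P * x₀ - Dj * y)
    unfold = solve-∀
    error-step : + (n ℕ.* P) * a (suc j) - d * d ℤ.^ j * a 0 ≡ + P * X + d * U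
    error-step = trans (cong (λ x → x * a (suc j) - d * d ℤ.^ j * a 0) (ℤP.pos-* n P))
                       (unfold (+ n) (+ P) (a (suc j)) (a j) d (d ℤ.^ j) (a 0))
    distribute : ∀ n P x D u → n ℕ.* (P ℕ.* x ℕ.+ D ℕ.* u) ≡ n ℕ.* P ℕ.* x ℕ.+ D ℕ.* (n ℕ.* u)
    distribute = ℕS.solve-∀
    complete-square : ∀ n P j M →
      n ℕ.* P ℕ.* (j ℕ.* (M ℕ.+ M)) ℕ.+ n ℕ.* (j ℕ.* j ℕ.* (M ℕ.* P)) ℕ.+ M ℕ.* (n ℕ.* P)
        ≡ suc j ℕ.* suc j ℕ.* (M ℕ.* (n ℕ.* P))
    complete-square = ℕS.solve-∀

  krawtchouk-approximation : ∀ {m n} k → m ℕ.≤ n → k ℕ.≤ n →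
    let V = scaled n (krawtchouk m (n ∸ m)) in
    n ℕ.* ∣ + (n ℕ.^ k) * V k - (+ (n ∸ m) - + m) ℤ.^ k * V 0 ∣
      ℕ.≤ k ℕ.* k ℕ.* (n ! ℕ.* n ℕ.^ k)
  krawtchouk-approximation {m} {n} k m≤n k≤n =
    geometric-approximation {n} {n !} {n} (scaled n K) ∣d∣≤n (scaled-step-bound rec ∣K∣≤C) k k≤n
    where
    p = n ∸ m
    K = krawtchouk m p
    m+p≡n : m ℕ.+ p ≡ n
    m+p≡n = ℕP.m+[n∸m]≡n m≤n
    rec : Recurrent (+ p - + m) (+ n) K
    rec = Recurrent-resp refl (cong +_ m+p≡n) (λ _ → refl) (krawtchouk-recurrent m p)
    ∣K∣≤C : ∀ j → ∣ K j ∣ ℕ.≤ n C j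
    ∣K∣≤C j = subst (λ x → ∣ K j ∣ ℕ.≤ x C j) m+p≡n (∣krawtchouk∣≤binomial m p j)
    ∣d∣≤n : ∣ + p - + m ∣ ℕ.≤ n
    ∣d∣≤n = ℕP.≤-trans (ℤP.∣i-j∣≤∣i∣+∣j∣ (+ p) (+ m))
                       (ℕP.≤-reflexive (trans (ℕP.+-comm p m) m+p≡n))

module RationalBounds where
  open import Data.Nat as ℕ using (ℕ; zero; suc)
  import Data.Nat.Coprimality as Coprime
  open import Data.Integer as ℤ using (ℤ; +_; -[1+_])
  import Data.Integer.Properties as ℤP
  open import Data.Rational
    using ( ℚ; mkℚ; 0ℚ; 1ℚ; _+_; _*_; _-_; -_; ∣_∣; _≤_; _<_; _/_; 1/_; *≤*
          ; positive; nonNegative; ≢-nonZero)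
  open import Data.Rational.Properties
  open import Data.Rational.Solver using (module +-*-Solver)
  open import Data.Empty using (⊥-elim)
  open import Data.Sum using (inj₁; inj₂)
  open import Relation.Binary.PropositionalEquality
  open import Relation.Nullary using (yes; no)
  open +-*-Solver

  ℤtoℚ : ℤ → ℚ
  ℤtoℚ i = i / 1

  ℤtoℚ≡mkℚ : ∀ i → ℤtoℚ i ≡ mkℚ i 0 (Coprime.sym (Coprime.1-coprimeTo ℤ.∣ i ∣))
  ℤtoℚ≡mkℚ (+ n)    = normalize-coprime (Coprime.sym (Coprime.1-coprimeTo n))
  ℤtoℚ≡mkℚ -[1+ n ] = cong -_ (normalize-coprime (Coprime.sym (Coprime.1-coprimeTo (suc n))))

  ℤtoℚ-+ : ∀ i j → ℤtoℚ (i ℤ.+ j) ≡ ℤtoℚ i + ℤtoℚ j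
  ℤtoℚ-+ i j rewrite ℤtoℚ≡mkℚ i | ℤtoℚ≡mkℚ j =
    cong (_/ 1) (sym (cong₂ ℤ._+_ (ℤP.*-identityʳ i) (ℤP.*-identityʳ j)))

  ℤtoℚ-* : ∀ i j → ℤtoℚ (i ℤ.* j) ≡ ℤtoℚ i * ℤtoℚ j
  ℤtoℚ-* i j rewrite ℤtoℚ≡mkℚ i | ℤtoℚ≡mkℚ j = refl

  ℤtoℚ-neg : ∀ i → ℤtoℚ (ℤ.- i) ≡ - ℤtoℚ i
  ℤtoℚ-neg (+ zero)  = refl
  ℤtoℚ-neg (+ suc n) = refl
  ℤtoℚ-neg -[1+ n ]  rewrite ℤtoℚ≡mkℚ -[1+ n ] | ℤtoℚ≡mkℚ (ℤ.- -[1+ n ]) = refl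

  ℤtoℚ-- : ∀ i j → ℤtoℚ (i ℤ.- j) ≡ ℤtoℚ i - ℤtoℚ j
  ℤtoℚ-- i j = trans (ℤtoℚ-+ i (ℤ.- j)) (cong (λ x → ℤtoℚ i + x) (ℤtoℚ-neg j))

  ℤtoℚ-∣∣ : ∀ i → ∣ ℤtoℚ i ∣ ≡ ℕtoℚ ℤ.∣ i ∣
  ℤtoℚ-∣∣ i rewrite ℤtoℚ≡mkℚ i | ℤtoℚ≡mkℚ (+ ℤ.∣ i ∣) = refl

  ℤtoℚ-mono-≤ : ∀ {i j} → i ℤ.≤ j → ℤtoℚ i ≤ ℤtoℚ j
  ℤtoℚ-mono-≤ {i} {j} i≤j rewrite ℤtoℚ≡mkℚ i | ℤtoℚ≡mkℚ j =
    *≤* (subst₂ ℤ._≤_ (sym (ℤP.*-identityʳ i)) (sym (ℤP.*-identityʳ j)) i≤j)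

  ℤtoℚ-^ : ∀ i k → ℤtoℚ i ^ℚ k ≡ ℤtoℚ (i ℤ.^ k)
  ℤtoℚ-^ i zero    = refl
  ℤtoℚ-^ i (suc k) = trans (cong (ℤtoℚ i *_) (ℤtoℚ-^ i k)) (sym (ℤtoℚ-* i (i ℤ.^ k)))

  ℕtoℚ-nonNeg : ∀ n → 0ℚ ≤ ℕtoℚ n
  ℕtoℚ-nonNeg n = ℤtoℚ-mono-≤ {+ 0} {+ n} (ℤ.+≤+ ℕ.z≤n)

  ℕtoℚ-pos : ∀ n .{{_ : ℕ.NonZero n}} → 0ℚ < ℕtoℚ n
  ℕtoℚ-pos (suc n) rewrite ℤtoℚ≡mkℚ (+ suc n) = positive⁻¹ (mkℚ (+ suc n) 0 _)

  ℕtoℚ-mono-≤ : ∀ {m n} → m ℕ.≤ n → ℕtoℚ m ≤ ℕtoℚ n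
  ℕtoℚ-mono-≤ {m} {n} m≤n = ℤtoℚ-mono-≤ {+ m} {+ n} (ℤ.+≤+ m≤n)

  ℕtoℚ-* : ∀ m n → ℕtoℚ (m ℕ.* n) ≡ ℕtoℚ m * ℕtoℚ n
  ℕtoℚ-* m n = trans (cong ℤtoℚ (ℤP.pos-* m n)) (ℤtoℚ-* (+ m) (+ n))

  ℕtoℚ-^ : ∀ n k → ℕtoℚ (n ℕ.^ k) ≡ ℕtoℚ n ^ℚ k
  ℕtoℚ-^ n zero    = refl
  ℕtoℚ-^ n (suc k) = trans (ℕtoℚ-* n (n ℕ.^ k)) (cong (ℕtoℚ n *_) (ℕtoℚ-^ n k))

  ℕtoℚ-suc : ∀ n → ℕtoℚ (suc n) ≡ 1ℚ + ℕtoℚ n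
  ℕtoℚ-suc n = ℤtoℚ-+ (+ 1) (+ n)

  divQ-cancelʳ : ∀ p q → q ≢ 0ℚ → divQ p q * q ≡ p
  divQ-cancelʳ p q q≢0 with q ≟ 0ℚ
  ... | yes q≡0 = ⊥-elim (q≢0 q≡0)
  ... | no  q≢0 = trans (*-assoc p (1/ q) q) (trans (cong (p *_) (*-inverseˡ q)) (*-identityʳ p))
    where instance _ = ≢-nonZero q≢0

  0≤1 : 0ℚ ≤ 1ℚ
  0≤1 = *≤* (ℤ.+≤+ ℕ.z≤n)

  *-monoˡ-≤-≥0 : ∀ {r p q} → 0ℚ ≤ r → p ≤ q → r * p ≤ r * q
  *-monoˡ-≤-≥0 {r} 0≤r = *-monoˡ-≤-nonNeg r {{nonNegative 0≤r}}

  *-monoʳ-≤-≥0 : ∀ {r p q} → 0ℚ ≤ r → p ≤ q → p * r ≤ q * r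
  *-monoʳ-≤-≥0 {r} 0≤r = *-monoʳ-≤-nonNeg r {{nonNegative 0≤r}}

  *-mono-≤-≥0 : ∀ {p q r s} → 0ℚ ≤ p → 0ℚ ≤ r → p ≤ q → r ≤ s → p * r ≤ q * s
  *-mono-≤-≥0 0≤p 0≤r p≤q r≤s = ≤-trans (*-monoʳ-≤-≥0 0≤r p≤q) (*-monoˡ-≤-≥0 (≤-trans 0≤p p≤q) r≤s)

  *-cancelʳ-≤->0 : ∀ {r p q} → 0ℚ < r → p * r ≤ q * r → p ≤ q
  *-cancelʳ-≤->0 {r} 0<r = *-cancelʳ-≤-pos r {{positive 0<r}}

  *-≥0 : ∀ {p q} → 0ℚ ≤ p → 0ℚ ≤ q → 0ℚ ≤ p * q
  *-≥0 {p} 0≤p 0≤q = subst (_≤ p * _) (*-zeroʳ p) (*-monoˡ-≤-≥0 0≤p 0≤q)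

  x*x≥0 : ∀ x → 0ℚ ≤ x * x
  x*x≥0 x with ≤-total 0ℚ x
  ... | inj₁ 0≤x = *-≥0 0≤x 0≤x
  ... | inj₂ x≤0 = subst (0ℚ ≤_) (solve 1 (λ x → (:- x) :* (:- x) := x :* x) refl x) (*-≥0 0≤-x 0≤-x)
    where
    0≤-x : 0ℚ ≤ - x
    0≤-x = neg-antimono-≤ x≤0

  ≤-+-≥0 : ∀ {p q} → 0ℚ ≤ q → p ≤ p + q
  ≤-+-≥0 {p} 0≤q = subst (_≤ p + _) (+-identityʳ p) (+-monoʳ-≤ p 0≤q)

  1^ℚ : ∀ k → 1ℚ ^ℚ k ≡ 1ℚ
  1^ℚ zero    = refl
  1^ℚ (suc k) = trans (*-identityˡ (1ℚ ^ℚ k)) (1^ℚ k)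

  ^ℚ-distribʳ-* : ∀ x y k → (x * y) ^ℚ k ≡ x ^ℚ k * y ^ℚ k
  ^ℚ-distribʳ-* x y zero    = refl
  ^ℚ-distribʳ-* x y (suc k) rewrite ^ℚ-distribʳ-* x y k =
    solve 4 (λ x y a b → (x :* y) :* (a :* b) := (x :* a) :* (y :* b)) refl x y (x ^ℚ k) (y ^ℚ k)

  ^ℚ-comm : ∀ x a b → (x ^ℚ a) ^ℚ b ≡ (x ^ℚ b) ^ℚ a
  ^ℚ-comm x a zero    = sym (1^ℚ a)
  ^ℚ-comm x a (suc b) rewrite ^ℚ-comm x a b = sym (^ℚ-distribʳ-* x (x ^ℚ b) a)

  ^ℚ-≥0 : ∀ {x} k → 0ℚ ≤ x → 0ℚ ≤ x ^ℚ k
  ^ℚ-≥0 zero    _   = 0≤1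
  ^ℚ-≥0 (suc k) 0≤x = *-≥0 0≤x (^ℚ-≥0 k 0≤x)

  ^ℚ-even-≥0 : ∀ x q → 0ℚ ≤ x ^ℚ (q ℕ.* 2)
  ^ℚ-even-≥0 x zero    = 0≤1
  ^ℚ-even-≥0 x (suc q) = subst (0ℚ ≤_) (*-assoc x x (x ^ℚ (q ℕ.* 2))) (*-≥0 (x*x≥0 x) (^ℚ-even-≥0 x q))

  *->0 : ∀ {p q} → 0ℚ < p → 0ℚ < q → 0ℚ < p * q
  *->0 {p} {q} 0<p 0<q = positive⁻¹ (p * q) {{pos*pos⇒pos p {{positive 0<p}} q {{positive 0<q}}}}

  ^ℚ->0 : ∀ {x} k → 0ℚ < x → 0ℚ < x ^ℚ k
  ^ℚ->0 zero    _   = positive⁻¹ 1ℚ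
  ^ℚ->0 (suc k) 0<x = *->0 0<x (^ℚ->0 k 0<x)

  ^ℚ-mono-≤ : ∀ {x y} k → 0ℚ ≤ x → x ≤ y → x ^ℚ k ≤ y ^ℚ k
  ^ℚ-mono-≤ zero    _   _   = ≤-refl
  ^ℚ-mono-≤ (suc k) 0≤x x≤y = *-mono-≤-≥0 0≤x (^ℚ-≥0 k 0≤x) x≤y (^ℚ-mono-≤ k 0≤x x≤y)

  ∣^ℚ∣ : ∀ x k → ∣ x ^ℚ k ∣ ≡ ∣ x ∣ ^ℚ k
  ∣^ℚ∣ x zero    = refl
  ∣^ℚ∣ x (suc k) = trans (∣p*q∣≡∣p∣*∣q∣ x (x ^ℚ k)) (cong (∣ x ∣ *_) (∣^ℚ∣ x k))

  bernoulli : ∀ {y} → 0ℚ ≤ 1ℚ + y → ∀ j → 1ℚ + ℕtoℚ j * y ≤ (1ℚ + y) ^ℚ j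
  bernoulli {y} _ zero = ≤-reflexive (trans (cong (λ z → 1ℚ + z) (*-zeroˡ y)) (+-identityʳ 1ℚ))
  bernoulli {y} 0≤1+y (suc j) = begin
    1ℚ + ℕtoℚ (suc j) * y
      ≡⟨ cong (λ z → 1ℚ + z * y) (ℕtoℚ-suc j) ⟩
    1ℚ + (1ℚ + jq) * y
      ≤⟨ ≤-+-≥0 (*-≥0 (ℕtoℚ-nonNeg j) (x*x≥0 y)) ⟩
    1ℚ + (1ℚ + jq) * y + jq * (y * y)
      ≡⟨ solve 2 (λ J y → con 1ℚ :+ (con 1ℚ :+ J) :* y :+ J :* (y :* y)
        := (con 1ℚ :+ y) :* (con 1ℚ :+ J :* y)) refl jq y ⟩
    (1ℚ + y) * (1ℚ + jq * y)
      ≤⟨ *-monoˡ-≤-≥0 0≤1+y (bernoulli 0≤1+y j) ⟩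
    (1ℚ + y) * (1ℚ + y) ^ℚ j ∎
    where
    open ≤-Reasoning
    jq = ℕtoℚ j

  [1+y]^L≤2 : ∀ {y} L → 0ℚ ≤ y → y ≤ 1ℚ → ℕtoℚ L * y + ℕtoℚ L * y ≤ 1ℚ →
              (1ℚ + y) ^ℚ L ≤ 1ℚ + 1ℚ
  [1+y]^L≤2 {y} L 0≤y y≤1 2Ly≤1 = begin
    P
      ≡⟨ *-identityʳ P ⟨
    P * 1ℚ
      ≤⟨ *-monoˡ-≤-≥0 (^ℚ-≥0 L 0≤1+y) 1≤Q+Q ⟩
    P * (Q + Q)
      ≡⟨ *-distribˡ-+ P Q Q ⟩
    P * Q + P * Q
      ≤⟨ +-mono-≤ PQ≤1 PQ≤1 ⟩
    1ℚ + 1ℚ ∎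
    where
    open ≤-Reasoning
    P = (1ℚ + y) ^ℚ L
    Q = (1ℚ - y) ^ℚ L
    Ly = ℕtoℚ L * y
    0≤1+y : 0ℚ ≤ 1ℚ + y
    0≤1+y = ≤-trans 0≤1 (≤-+-≥0 0≤y)
    0≤1-y : 0ℚ ≤ 1ℚ - y
    0≤1-y = subst (_≤ 1ℚ - y) (+-inverseʳ y) (+-monoˡ-≤ (- y) y≤1)
    1-Ly≤Q : 1ℚ - Ly ≤ Q
    1-Ly≤Q = subst (λ z → 1ℚ + z ≤ Q) (sym (neg-distribʳ-* (ℕtoℚ L) y)) (bernoulli 0≤1-y L)
    1≤Q+Q : 1ℚ ≤ Q + Q
    1≤Q+Q = begin
      1ℚ
        ≡⟨ solve 0 (con 1ℚ := (con 1ℚ :+ con 1ℚ) :- con 1ℚ) refl ⟩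
      (1ℚ + 1ℚ) - 1ℚ
        ≤⟨ +-monoʳ-≤ (1ℚ + 1ℚ) (neg-antimono-≤ 2Ly≤1) ⟩
      (1ℚ + 1ℚ) - (Ly + Ly)
        ≡⟨ solve 1 (λ a → (con 1ℚ :+ con 1ℚ) :- (a :+ a) := (con 1ℚ :- a) :+ (con 1ℚ :- a)) refl Ly ⟩
      (1ℚ - Ly) + (1ℚ - Ly)
        ≤⟨ +-mono-≤ 1-Ly≤Q 1-Ly≤Q ⟩
      Q + Q ∎
    0≤1-y*y : 0ℚ ≤ 1ℚ - y * y
    0≤1-y*y = subst (_≤ 1ℚ - y * y) (+-inverseʳ (y * y))
                (+-monoˡ-≤ (- (y * y)) (*-mono-≤-≥0 0≤y 0≤y y≤1 y≤1))
    1-y*y≤1 : 1ℚ - y * y ≤ 1ℚ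
    1-y*y≤1 = subst (1ℚ - y * y ≤_) (+-identityʳ 1ℚ) (+-monoʳ-≤ 1ℚ (neg-antimono-≤ (x*x≥0 y)))
    PQ≤1 : P * Q ≤ 1ℚ
    PQ≤1 = begin
      P * Q
        ≡⟨ ^ℚ-distribʳ-* (1ℚ + y) (1ℚ - y) L ⟨
      ((1ℚ + y) * (1ℚ - y)) ^ℚ L
        ≡⟨ cong (_^ℚ L) (solve 1 (λ y → (con 1ℚ :+ y) :* (con 1ℚ :- y) := con 1ℚ :- y :* y) refl y) ⟩
      (1ℚ - y * y) ^ℚ L
        ≤⟨ ^ℚ-mono-≤ L 0≤1-y*y 1-y*y≤1 ⟩
      1ℚ ^ℚ L
        ≡⟨ 1^ℚ L ⟩
      1ℚ ∎

  [1+x]^L≤2^[D+D] : ∀ {x} n D L .{{_ : ℕ.NonZero n}} →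
                    0ℚ ≤ x → x * ℕtoℚ n ≤ ℕtoℚ D → L ℕ.≤ n →
                    (1ℚ + x) ^ℚ L ≤ (1ℚ + 1ℚ) ^ℚ (D ℕ.+ D)
  [1+x]^L≤2^[D+D] {x} n D L 0≤x xN≤D L≤N = begin
    (1ℚ + x) ^ℚ L
      ≤⟨ ^ℚ-mono-≤ L (≤-trans 0≤1 (≤-+-≥0 0≤x)) 1+x≤[1+y]^[D+D] ⟩
    ((1ℚ + y) ^ℚ (D ℕ.+ D)) ^ℚ L
      ≡⟨ ^ℚ-comm (1ℚ + y) (D ℕ.+ D) L ⟩
    ((1ℚ + y) ^ℚ L) ^ℚ (D ℕ.+ D)
      ≤⟨ ^ℚ-mono-≤ (D ℕ.+ D) (^ℚ-≥0 L (≤-trans 0≤1 (≤-+-≥0 0≤y)))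
        ([1+y]^L≤2 L 0≤y y≤1 2Ly≤1) ⟩
    (1ℚ + 1ℚ) ^ℚ (D ℕ.+ D) ∎
    where
    open ≤-Reasoning
    N = ℕtoℚ n
    0<N+N : 0ℚ < N + N
    0<N+N = +-mono-< (ℕtoℚ-pos n) (ℕtoℚ-pos n)
    y = divQ 1ℚ (N + N)
    y[N+N]≡1 : y * (N + N) ≡ 1ℚ
    y[N+N]≡1 = divQ-cancelʳ 1ℚ (N + N) (λ e → <-irrefl (sym e) 0<N+N)
    0≤y : 0ℚ ≤ y
    0≤y = *-cancelʳ-≤->0 0<N+N (subst₂ _≤_ (sym (*-zeroˡ (N + N))) (sym y[N+N]≡1) 0≤1)
    y≤1 : y ≤ 1ℚ
    y≤1 = *-cancelʳ-≤->0 0<N+N (begin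
      y * (N + N)
        ≡⟨ y[N+N]≡1 ⟩
      1ℚ
        ≤⟨ ≤-trans (ℕtoℚ-mono-≤ (ℕ.>-nonZero⁻¹ n)) (≤-+-≥0 (ℕtoℚ-nonNeg n)) ⟩
      N + N
        ≡⟨ *-identityˡ (N + N) ⟨
      1ℚ * (N + N) ∎)
    2Ly≤1 : ℕtoℚ L * y + ℕtoℚ L * y ≤ 1ℚ
    2Ly≤1 = begin
      ℕtoℚ L * y + ℕtoℚ L * y
        ≤⟨ +-mono-≤ Ly≤Ny Ly≤Ny ⟩
      N * y + N * y
        ≡⟨ solve 2 (λ N y → N :* y :+ N :* y := y :* (N :+ N)) refl N y ⟩
      y * (N + N)
        ≡⟨ y[N+N]≡1 ⟩
      1ℚ ∎
      where
      Ly≤Ny = *-monoʳ-≤-≥0 0≤y (ℕtoℚ-mono-≤ L≤N)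
    x≤[D+D]y : x ≤ ℕtoℚ (D ℕ.+ D) * y
    x≤[D+D]y = *-cancelʳ-≤->0 (ℕtoℚ-pos n) (begin
      x * N
        ≤⟨ xN≤D ⟩
      ℕtoℚ D
        ≡⟨ *-identityʳ (ℕtoℚ D) ⟨
      ℕtoℚ D * 1ℚ
        ≡⟨ cong (ℕtoℚ D *_) y[N+N]≡1 ⟨
      ℕtoℚ D * (y * (N + N))
        ≡⟨ solve 3 (λ d y N → d :* (y :* (N :+ N)) := (d :+ d) :* y :* N) refl (ℕtoℚ D) y N ⟩
      (ℕtoℚ D + ℕtoℚ D) * y * N
        ≡⟨ cong (λ z → z * y * N) (ℤtoℚ-+ (+ D) (+ D)) ⟨
      ℕtoℚ (D ℕ.+ D) * y * N ∎)
    1+x≤[1+y]^[D+D] : 1ℚ + x ≤ (1ℚ + y) ^ℚ (D ℕ.+ D)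
    1+x≤[1+y]^[D+D] =
      ≤-trans (+-monoʳ-≤ 1ℚ x≤[D+D]y) (bernoulli (≤-trans 0≤1 (≤-+-≥0 0≤y)) (D ℕ.+ D))

  ratio-bound : ∀ A {B} n D L .{{_ : ℕ.NonZero n}} →
                0ℚ ≤ B → ∣ A - B ∣ * ℕtoℚ n ≤ ℕtoℚ D → L ℕ.≤ n →
                ∣ divQ ((1ℚ + A) ^ℚ L) ((1ℚ + B) ^ℚ L) ∣ ≤ (1ℚ + 1ℚ) ^ℚ (D ℕ.+ D)
  ratio-bound A {B} n D L 0≤B δN≤D L≤N = *-cancelʳ-≤->0 0<den^L (begin
    ∣ r ∣ * den ^ℚ L
      ≡⟨ cong (∣ r ∣ *_) (0≤p⇒∣p∣≡p (<⇒≤ 0<den^L)) ⟨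
    ∣ r ∣ * ∣ den ^ℚ L ∣
      ≡⟨ ∣p*q∣≡∣p∣*∣q∣ r (den ^ℚ L) ⟨
    ∣ r * den ^ℚ L ∣
      ≡⟨ cong ∣_∣ (divQ-cancelʳ _ _ (λ e → <-irrefl (sym e) 0<den^L)) ⟩
    ∣ (1ℚ + A) ^ℚ L ∣
      ≡⟨ ∣^ℚ∣ (1ℚ + A) L ⟩
    ∣ 1ℚ + A ∣ ^ℚ L
      ≤⟨ ^ℚ-mono-≤ L (0≤∣p∣ (1ℚ + A)) ∣1+A∣≤den[1+δ] ⟩
    (den * (1ℚ + δ)) ^ℚ L
      ≡⟨ ^ℚ-distribʳ-* den (1ℚ + δ) L ⟩
    den ^ℚ L * (1ℚ + δ) ^ℚ L
      ≤⟨ *-monoˡ-≤-≥0 (<⇒≤ 0<den^L) ([1+x]^L≤2^[D+D] n D L (0≤∣p∣ (A - B)) δN≤D L≤N) ⟩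
    den ^ℚ L * (1ℚ + 1ℚ) ^ℚ (D ℕ.+ D)
      ≡⟨ *-comm (den ^ℚ L) _ ⟩
    (1ℚ + 1ℚ) ^ℚ (D ℕ.+ D) * den ^ℚ L ∎)
    where
    open ≤-Reasoning
    den = 1ℚ + B
    δ = ∣ A - B ∣
    r = divQ ((1ℚ + A) ^ℚ L) (den ^ℚ L)
    1≤den : 1ℚ ≤ den
    1≤den = ≤-+-≥0 0≤B
    0<den^L : 0ℚ < den ^ℚ L
    0<den^L = ^ℚ->0 L (<-≤-trans (positive⁻¹ 1ℚ) 1≤den)
    ∣1+A∣≤den[1+δ] : ∣ 1ℚ + A ∣ ≤ den * (1ℚ + δ)
    ∣1+A∣≤den[1+δ] = begin
      ∣ 1ℚ + A ∣
        ≡⟨ cong ∣_∣ (solve 2 (λ A B → con 1ℚ :+ A := (con 1ℚ :+ B) :+ (A :- B)) refl A B) ⟩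
      ∣ den + (A - B) ∣
        ≤⟨ ∣p+q∣≤∣p∣+∣q∣ den (A - B) ⟩
      ∣ den ∣ + δ
        ≡⟨ cong (_+ δ) (0≤p⇒∣p∣≡p (≤-trans 0≤1 1≤den)) ⟩
      den + δ
        ≤⟨ +-monoʳ-≤ den (subst (_≤ den * δ) (*-identityˡ δ) (*-monoʳ-≤-≥0 (0≤∣p∣ (A - B)) 1≤den)) ⟩
      den + den * δ
        ≡⟨ solve 2 (λ a d → a :+ a :* d := a :* (con 1ℚ :+ d)) refl den δ ⟩
      den * (1ℚ + δ) ∎

module Estimates where
  open Krawtchouk
  open RationalBounds
  open import Data.Nat as ℕ using (ℕ; _∸_; _!)
  import Data.Nat.Properties as ℕP
  open import Data.Nat.Combinatorics using (_C_)
  open import Data.Nat.Divisibility using (_∣_; divides)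
  open import Data.Integer as ℤ using (+_)
  import Data.Integer.Properties as ℤP
  open import Data.Rational using (ℚ; 0ℚ; 1ℚ; _+_; _*_; _-_; -_; ∣_∣; _≤_; _<_)
  open import Data.Rational.Properties
  open import Data.Rational.Solver using (module +-*-Solver)
  open import Data.Product using (_×_; _,_)
  open import Data.Sum using (_⊎_; inj₁; inj₂)
  open import Relation.Binary.PropositionalEquality
  open +-*-Solver

  ω/C : ℕ → ℕ → ℕ → ℚ
  ω/C n m k = divQ (ℤtoℚ (ω n m k)) (ℕtoℚ (n C k))

  τ : ℕ → ℕ → ℚ
  τ n m = 1ℚ - divQ (ℕtoℚ (2 ℕ.* m)) (ℕtoℚ n)

  τ*n≡n-2m : ∀ n m .{{_ : ℕ.NonZero n}} → τ n m * ℕtoℚ n ≡ ℕtoℚ n - ℕtoℚ 2 * ℕtoℚ m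
  τ*n≡n-2m n m = begin
    (1ℚ - a) * N
      ≡⟨ solve 2 (λ a N → (con 1ℚ :- a) :* N := N :- a :* N) refl a N ⟩
    N - a * N
      ≡⟨ cong (λ z → N - z) (divQ-cancelʳ _ N (λ e → <-irrefl (sym e) (ℕtoℚ-pos n))) ⟩
    N - ℕtoℚ (2 ℕ.* m)
      ≡⟨ cong (λ z → N - z) (ℕtoℚ-* 2 m) ⟩
    N - ℕtoℚ 2 * ℕtoℚ m ∎
    where
    open ≡-Reasoning
    N = ℕtoℚ n
    a = divQ (ℕtoℚ (2 ℕ.* m)) N

  τ*n≡[n∸m]-m : ∀ n m .{{_ : ℕ.NonZero n}} → m ℕ.≤ n →
                τ n m * ℕtoℚ n ≡ ℤtoℚ (+ (n ∸ m) ℤ.- + m)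
  τ*n≡[n∸m]-m n m m≤n = begin
    τ n m * ℕtoℚ n
      ≡⟨ τ*n≡n-2m n m ⟩
    ℕtoℚ n - ℕtoℚ 2 * M
      ≡⟨ cong (λ z → z - ℕtoℚ 2 * M) (trans (cong ℕtoℚ (sym (ℕP.m∸n+n≡m m≤n))) (ℤtoℚ-+ (+ p) (+ m))) ⟩
    ℕtoℚ p + M - ℕtoℚ 2 * M
      ≡⟨ solve 2 (λ p M → p :+ M :- con (ℕtoℚ 2) :* M := p :- M) refl (ℕtoℚ p) M ⟩
    ℕtoℚ p - M
      ≡⟨ ℤtoℚ-- (+ p) (+ m) ⟨
    ℤtoℚ (+ p ℤ.- + m) ∎
    where
    open ≡-Reasoning
    p = n ∸ m
    M = ℕtoℚ m

  τ^k-≥0 : ∀ n m k .{{_ : ℕ.NonZero n}} →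
           geqThreshold n k (- shift n m) ⊎ (2 ∣ k × geqThreshold n k (shift n m)) → 0ℚ ≤ τ n m ^ℚ k
  τ^k-≥0 n m k (inj₂ (divides q k≡q*2 , _)) =
    subst (λ j → 0ℚ ≤ τ n m ^ℚ j) (sym k≡q*2) (^ℚ-even-≥0 (τ n m) q)
  τ^k-≥0 n m k (inj₁ (0≤-shift , _)) = ^ℚ-≥0 k 0≤τ
    where
    open ≡-Reasoning
    N = ℕtoℚ n
    M = ℕtoℚ m
    h = divQ N (ℕtoℚ 2)
    τN≡-shift*2 : τ n m * N ≡ (- shift n m) * ℕtoℚ 2
    τN≡-shift*2 = begin
      τ n m * N
        ≡⟨ τ*n≡n-2m n m ⟩
      N - ℕtoℚ 2 * M
        ≡⟨ cong (λ z → z - ℕtoℚ 2 * M) (divQ-cancelʳ N (ℕtoℚ 2) (λ e → <-irrefl (sym e) (ℕtoℚ-pos 2))) ⟨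
      h * ℕtoℚ 2 - ℕtoℚ 2 * M
        ≡⟨ solve 3 (λ h t M → h :* t :- t :* M := (:- (M :- h)) :* t) refl h (ℕtoℚ 2) M ⟩
      (- (M - h)) * ℕtoℚ 2 ∎
    0≤τ : 0ℚ ≤ τ n m
    0≤τ = *-cancelʳ-≤->0 (ℕtoℚ-pos n)
            (subst₂ _≤_ (sym (*-zeroˡ N)) (sym τN≡-shift*2) (*-≥0 0≤-shift (ℕtoℚ-nonNeg 2)))

  ω/C*n!≡scaled : ∀ n m k → k ℕ.≤ n →
                  ω/C n m k * ℕtoℚ (n !) ≡ ℤtoℚ (scaled n (krawtchouk m (n ∸ m)) k)
  ω/C*n!≡scaled n m k k≤n = begin
    A * ℕtoℚ (n !)
      ≡⟨ cong (A *_) (trans (cong ℕtoℚ (sym (nCk*[k!*[n∸k]!]≡n! k≤n))) (ℕtoℚ-* nCk w)) ⟩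
    A * (ℕtoℚ nCk * ℕtoℚ w)
      ≡⟨ *-assoc A (ℕtoℚ nCk) (ℕtoℚ w) ⟨
    A * ℕtoℚ nCk * ℕtoℚ w
      ≡⟨ cong (_* ℕtoℚ w) (divQ-cancelʳ _ _ (λ e → <-irrefl (sym e) 0<nCk)) ⟩
    ℤtoℚ (ω n m k) * ℕtoℚ w
      ≡⟨ *-comm (ℤtoℚ (ω n m k)) (ℕtoℚ w) ⟩
    ℕtoℚ w * ℤtoℚ (ω n m k)
      ≡⟨ ℤtoℚ-* (+ w) (ω n m k) ⟨
    ℤtoℚ (+ w ℤ.* ω n m k)
      ≡⟨ cong (λ z → ℤtoℚ (z ℤ.* ω n m k)) (ℤP.pos-* (k !) ((n ∸ k) !)) ⟩
    ℤtoℚ (scaled n (krawtchouk m (n ∸ m)) k) ∎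
    where
    open ≡-Reasoning
    A = ω/C n m k
    nCk = n C k
    w = k ! ℕ.* (n ∸ k) !
    0<nCk : 0ℚ < ℕtoℚ nCk
    0<nCk = ℕtoℚ-pos nCk
              {{ℕP.m*n≢0⇒m≢0 nCk {{subst ℕ.NonZero (sym (nCk*[k!*[n∸k]!]≡n! k≤n)) (n ℕP.!≢0)}}}}

  krawtchouk-error : ∀ n m k .{{_ : ℕ.NonZero n}} → m ℕ.≤ n → k ℕ.≤ n →
                     ∣ ω/C n m k - τ n m ^ℚ k ∣ * ℕtoℚ n ≤ ℕtoℚ (k ℕ.* k)
  krawtchouk-error n m k m≤n k≤n = *-cancelʳ-≤->0 0<FP (begin
    δ * N * FP
      ≡⟨ solve 3 (λ δ N F → δ :* N :* F := N :* (δ :* F)) refl δ N FP ⟩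
    N * (δ * FP)
      ≡⟨ cong (λ z → N * (δ * z)) (0≤p⇒∣p∣≡p (<⇒≤ 0<FP)) ⟨
    N * (δ * ∣ FP ∣)
      ≡⟨ cong (N *_) (∣p*q∣≡∣p∣*∣q∣ (A - B) FP) ⟨
    N * ∣ (A - B) * FP ∣
      ≡⟨ cong (λ z → N * ∣ z ∣) [A-B]*FP≡U ⟩
    N * ∣ ℤtoℚ U ∣
      ≡⟨ cong (N *_) (ℤtoℚ-∣∣ U) ⟩
    N * ℕtoℚ ℤ.∣ U ∣
      ≡⟨ ℕtoℚ-* n ℤ.∣ U ∣ ⟨
    ℕtoℚ (n ℕ.* ℤ.∣ U ∣)
      ≤⟨ ℕtoℚ-mono-≤ (krawtchouk-approximation k m≤n k≤n) ⟩
    ℕtoℚ (k ℕ.* k ℕ.* (n ! ℕ.* n ℕ.^ k))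
      ≡⟨ ℕtoℚ-* (k ℕ.* k) (n ! ℕ.* n ℕ.^ k) ⟩
    ℕtoℚ (k ℕ.* k) * ℕtoℚ (n ! ℕ.* n ℕ.^ k)
      ≡⟨ cong (ℕtoℚ (k ℕ.* k) *_) (ℕtoℚ-* (n !) (n ℕ.^ k)) ⟩
    ℕtoℚ (k ℕ.* k) * FP ∎)
    where
    open ≤-Reasoning
    d = + (n ∸ m) ℤ.- + m
    V = scaled n (krawtchouk m (n ∸ m))
    U = + (n ℕ.^ k) ℤ.* V k ℤ.- d ℤ.^ k ℤ.* V 0
    N = ℕtoℚ n
    F = ℕtoℚ (n !)
    P = ℕtoℚ (n ℕ.^ k)
    FP = F * P
    A = ω/C n m k
    B = τ n m ^ℚ k
    δ = ∣ A - B ∣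
    0<FP : 0ℚ < FP
    0<FP = *->0 (ℕtoℚ-pos (n !) {{n ℕP.!≢0}}) (ℕtoℚ-pos (n ℕ.^ k) {{ℕP.m^n≢0 n k}})
    BP≡d^k : B * P ≡ ℤtoℚ (d ℤ.^ k)
    BP≡d^k = begin-equality
      B * P
        ≡⟨ cong (B *_) (ℕtoℚ-^ n k) ⟩
      τ n m ^ℚ k * N ^ℚ k
        ≡⟨ ^ℚ-distribʳ-* (τ n m) N k ⟨
      (τ n m * N) ^ℚ k
        ≡⟨ cong (_^ℚ k) (τ*n≡[n∸m]-m n m m≤n) ⟩
      ℤtoℚ d ^ℚ k
        ≡⟨ ℤtoℚ-^ d k ⟩
      ℤtoℚ (d ℤ.^ k) ∎
    V₀≡F : ℤtoℚ (V 0) ≡ F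
    V₀≡F = cong ℤtoℚ (trans (scaled-zero n (krawtchouk m (n ∸ m))) (ℤP.*-identityʳ (+ (n !))))
    [A-B]*FP≡U : (A - B) * FP ≡ ℤtoℚ U
    [A-B]*FP≡U = begin-equality
      (A - B) * (F * P)
        ≡⟨ solve 4 (λ A B F P → (A :- B) :* (F :* P) := P :* (A :* F) :- (B :* P) :* F) refl A B F P ⟩
      P * (A * F) - (B * P) * F
        ≡⟨ cong₂ (λ x y → P * x - y * F) (ω/C*n!≡scaled n m k k≤n) BP≡d^k ⟩
      P * ℤtoℚ (V k) - ℤtoℚ (d ℤ.^ k) * F
        ≡⟨ cong (λ z → P * ℤtoℚ (V k) - ℤtoℚ (d ℤ.^ k) * z) V₀≡F ⟨
      P * ℤtoℚ (V k) - ℤtoℚ (d ℤ.^ k) * ℤtoℚ (V 0)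
        ≡⟨ cong₂ _-_ (ℤtoℚ-* (+ (n ℕ.^ k)) (V k)) (ℤtoℚ-* (d ℤ.^ k) (V 0)) ⟨
      ℤtoℚ (+ (n ℕ.^ k) ℤ.* V k) - ℤtoℚ (d ℤ.^ k ℤ.* V 0)
        ≡⟨ ℤtoℚ-- (+ (n ℕ.^ k) ℤ.* V k) (d ℤ.^ k ℤ.* V 0) ⟨
      ℤtoℚ U ∎

open Estimates using (ω/C; τ; τ^k-≥0; krawtchouk-error)
open RationalBounds using (ratio-bound)
import Data.Nat as ℕ
import Data.Nat.Properties as ℕP
open import Data.Nat using (ℕ; _≤_)
open import Data.Nat.Divisibility using (_∣_)
open import Data.Rational as ℚ using (ℚ)
open import Data.Product using (Σ; _×_; _,_)
open import Data.Sum using (_⊎_)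
open import Relation.Nullary using (contradiction)

lemma2 : (k : ℕ) → 3 ≤ k →
    Σ ℚ λ C → Σ ℕ λ N →
      (n m L : ℕ) → N ≤ n → k ≤ n → m ≤ n → L ≤ n →
      (geqThreshold n k (ℚ.- shift n m) ⊎ (2 ∣ k × geqThreshold n k (shift n m))) →
      ℚ.∣ divQ (numBase n m k ^ℚ L) (denBase n m k ^ℚ L) ∣ ℚ.≤ C
lemma2 k 3≤k = (ℚ.1ℚ ℚ.+ ℚ.1ℚ) ^ℚ (k ℕ.* k ℕ.+ k ℕ.* k) , 0 , λ where
  ℕ.zero m L _ k≤0 → contradiction (ℕP.≤-trans 3≤k k≤0) λ ()
  n@(ℕ.suc _) m L _ k≤n m≤n L≤n sign →
    ratio-bound (ω/C n m k) n (k ℕ.* k) L (τ^k-≥0 n m k sign) (krawtchouk-error n m k m≤n k≤n) L≤n
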